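{- Let $\mathcal{G}=(V,E_L,E_R)$ be an achievement positional game and let $u,v\in V$. Suppose $\{u\},\{v\}\notin E_L\cup E_R$, and that for all $e\in E_L\cup E_R$, $u\in e$ implies $v\in e$. Then (i) $o(\mathcal{G}_u)\leq_L o(\mathcal{G}_v)$; (ii) $o(\mathcal{G}^v)\leq_L o(\mathcal{G}^u)$; (iii) $o(\mathcal{G}_u^v)\leq_L o(\mathcal{G})\leq_L o(\mathcal{G}_v^u)$.
   Context: An achievement positional game is a triple $\mathcal{G}=(V,E_L,E_R)$ where $V$ is a finite set and $E_L, E_R \subseteq 2^V\setminus\{\varnothing\}$ (blue and red edges). Left and Right alternately pick a previously unpicked vertex; whoever first fills (picks all vertices of) an edge of their own color (blue for Left, red for Right) wins; if no one does before all vertices are picked, the game is a draw. For a set of edges $E$ and $S\subseteq V$, $E^{+S}=\{e\setminus S: e\in E\}$ and $E^{ -S}=\{e\in E: e\cap S=\varnothing\}$. For disjoint $V_L,V_R\subseteq V$, $\mathcal{G}_{V_L}^{V_R}=(V\setminus(V_L\cup V_R), (E_L^{+V_L})^{ -V_R}, (E_R^{+V_R})^{ -V_L})$ is the game after Left has picked $V_L$ and Right has picked $V_R$; curly brackets are omitted for singletons and an empty index is omitted (so $\mathcal{G}_u$: Left picked $u$; $\mathcal{G}^v$: Right picked $v$; $\mathcal{G}_u^v$: Left picked $u$ and Right picked $v$). The outcome $o(\mathcal{G})$ is the pair (result under optimal play when Left starts, result under optimal play when Right starts); $\leq_L$ compares outcomes componentwise from Left's viewpoint with Right win $<$ draw $<$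 Left win. -}

module Defs where

open import Data.Bool using (Bool; true; false; not; if_then_else_; _∧_)
open import Data.Nat using (ℕ; zero; suc; _≤_)
open import Data.Fin using (Fin)
open import Data.Fin.Subset using (Subset; _─_; _∪_; _∩_; ⁅_⁆; ⊥; ∣_∣; _⊆_; Nonempty)
open import Data.List using (List; []; _∷_; map; filter; foldr; allFin; _++_)
open import Data.Bool.ListAction using (any; all)
open import Data.List.Relation.Unary.All using (All)
open import Data.Vec using (lookup; toList)
open import Data.Product using (_×_; _,_)
open import Relation.Nullary.Decidable using (yes; no)
open import Relation.Unary using (Decidable)
open import Relation.Binary.PropositionalEquality using (_≡_)
open import Data.Bool.Properties using () renaming (_≟_ to _≟B_)

-- Achievement positional games over a universe Fin N.
-- The vertex set V is a subset of Fin N; edges are subsets of Fin N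
-- (lists of them: duplicates are irrelevant for the game).

record Game (N : ℕ) : Set where
  constructor game
  field
    V  : Subset N
    EL : List (Subset N)
    ER : List (Subset N)
open Game public

WellFormed : ∀ {N} → Game N → Set
WellFormed G = All (λ e → (e ⊆ V G) × Nonempty e) (EL G ++ ER G)

isEmpty : ∀ {N} → Subset N → Bool
isEmpty p = all not (toList p)

disjoint : ∀ {N} → Subset N → Subset N → Bool
disjoint p q = isEmpty (p ∩ q)

plus : ∀ {N} → List (Subset N) → Subset N → List (Subset N)
plus E S = map (λ e → e ─ S) E

minus : ∀ {N} → List (Subset N) → Subset N → List (Subset N)
minus E S = filter (λ e → disjoint e S ≟B true) E

after : ∀ {N} → Subset N → Subset N → Game N → Game N
after VL VR G = game (V G ─ (VL ∪ VR)) (minus (plus (EL G) VL) VR) (minus (plus (ER G) VR) VL)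

-- notation: G_u (Left picked u), G^v (Right picked v), G_u^v
_L[_] : ∀ {N} → Game N → Fin N → Game N
G L[ u ] = after ⁅ u ⁆ ⊥ G

_R[_] : ∀ {N} → Game N → Fin N → Game N
G R[ v ] = after ⊥ ⁅ v ⁆ G

_LR[_,_] : ∀ {N} → Game N → Fin N → Fin N → Game N
G LR[ u , v ] = after ⁅ u ⁆ ⁅ v ⁆ G

data Result : Set where
  rwin draw lwin : Result

rank : Result → ℕ
rank rwin = 0
rank draw = 1
rank lwin = 2

_≤R_ : Result → Result → Set
a ≤R b = rank a ≤ rank b

maxR : Result → Result → Result
maxR lwin _ = lwin
maxR _ lwin = lwin
maxR draw _ = draw
maxR _ draw = draw
maxR rwin rwin = rwin

minR : Result → Result → Result
minR rwin _ = rwin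
minR _ rwin = rwin
minR draw _ = draw
minR _ draw = draw
minR lwin lwin = lwin

-- no available move: the game is over (all vertices picked) = draw
bestFor : (Result → Result → Result) → List Result → Result
bestFor op [] = draw
bestFor op (r ∷ rs) = foldr op r rs

data Player : Set where
  Left Right : Player

moves : ∀ {N} → Game N → List (Fin N)
moves {N} G = filter (λ x → lookup (V G) x ≟B true) (allFin N)

-- optimal-play result with the given player to move; the natural number
-- is fuel, and `outcome` supplies |V|, which is exactly the number of
-- remaining moves (each move removes one vertex from V).
value : ∀ {N} → ℕ → Player → Game N → Result
value zero _ _ = draw
value (suc k) Left G = bestFor maxR (map step (moves G))
  where
  step : _ → Result
  step x = if any (λ e → isEmpty (e ─ ⁅ x ⁆)) (EL G) then lwin
           else value k Right (G L[ x ])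
value (suc k) Right G = bestFor minR (map step (moves G))
  where
  step : _ → Result
  step x = if any (λ e → isEmpty (e ─ ⁅ x ⁆)) (ER G) then rwin
           else value k Left (G R[ x ])

Outcome : Set
Outcome = Result × Result

o : ∀ {N} → Game N → Outcome
o G = value (∣ V G ∣) Left G , value (∣ V G ∣) Right G

_≤L_ : Outcome → Outcome → Set
(a , b) ≤L (c , d) = (a ≤R c) × (b ≤R d)

module Submission where

-- Two strategy-transfer arguments, by induction on the number of free vertices.
-- (i) Swapping u and v maps G_u to a position that G_v dominates: a blue edge
-- e ∖ {u} becomes e ∖ {v} (e contains v since it contains u), and a red edge
-- of G_v avoids v, hence u, so it is already a red edge of G_u; a position
-- dominating another up to relabelling is worth at least as much to Left.
-- (iii) In G, Left follows her strategy for G_u^v and answers Right's u by v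
-- and v by u. Since every edge through u contains v, the position reached
-- dominates the corresponding one of G_u^v, and {v} ∉ E_R guarantees that
-- Right never wins by taking u or v.
-- (ii) and the second half of (iii) follow by exchanging the colours.

open import Defs
open import Data.Bool using (Bool; true; false; if_then_else_)
open import Data.Bool.ListAction using (any)
open import Data.Bool.Properties using (T-≡) renaming (_≟_ to _≟B_)
open import Data.Empty using (⊥-elim)
open import Data.Fin using (Fin; zero)
open import Data.Fin.Permutation using (Permutation′; _⟨$⟩ʳ_; _⟨$⟩ˡ_; inverseˡ; inverseʳ; flip; transpose)
  renaming (id to idₚ)
import Data.Fin.Permutation.Components as PC
open import Data.Fin.Properties using (_≟_)
open import Data.Fin.Subset
  using (Subset; inside; outside; _∈_; _∉_; _⊆_; ⁅_⁆; _─_; _-_; _∪_; ⊥; ∣_∣; Nonempty)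
open import Data.Fin.Subset.Properties
  using (drop-there; ∉⊥; x∈⁅x⁆; x∈⁅y⁆⇒x≡y; x≢y⇒x∉⁅y⁆; x∉⁅y⁆⇒x≢y; x∈p∩q⁺; x∈p∩q⁻;
         x∈p∧x∉q⇒x∈p─q; x∈p∧x≢y⇒x∈p-y; p─q⊆p; p─⊥≡p; p─q─r≡p─q∪r; p─x─y≡p─y─x;
         ∪-comm; ∪-identityˡ; ∪-identityʳ; ⊆-antisym)
open import Data.List using (List; []; _∷_; _++_; map; foldr; allFin)
open import Data.List.Membership.Propositional using (find; lose) renaming (_∈_ to _∈ₗ_)
open import Data.List.Membership.Propositional.Properties
  using (∈-map⁺; ∈-map⁻; ∈-filter⁺; ∈-filter⁻; ∈-allFin; ∈-++⁺ˡ; ∈-++⁺ʳ)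
open import Data.List.Properties using (map-cong; map-∘)
open import Data.List.Relation.Unary.All using () renaming (lookup to All-lookup)
open import Data.List.Relation.Unary.Any using (here; there)
open import Data.List.Relation.Unary.Any.Properties using (any⁺; any⁻)
open import Data.Nat using (ℕ; zero; suc; _≤_; z≤n; _⊔_; _⊓_; _∸_; s≤s; s≤s⁻¹)
open import Data.Nat.Properties
  using (≤-refl; ≤-reflexive; ≤-trans; m≤m⊔n; m≤n⊔m; ⊔-lub; m⊓n≤m; m⊓n≤n; ⊓-glb; ∸-monoʳ-≤;
         suc-injective)
open import Data.Product using (_×_; _,_; ∃; proj₁; proj₂)
open import Data.Vec using ([]; _∷_; here; there; lookup)
open import Data.Vec.Properties using ([]=⇒lookup; lookup⇒[]=)
open import Function using (_∘_; _⇔_; mk⇔; Equivalence; case_of_)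
open import Relation.Binary.PropositionalEquality
  using (_≡_; _≢_; refl; sym; trans; cong; cong₂; subst; subst₂; module ≡-Reasoning)
open import Relation.Nullary using (¬_; yes; no)
open import Relation.Nullary.Decidable using (dec-true; dec-false)

private
  variable
    N k : ℕ
    G H H' : Game N
    E : List (Subset N)
    p q : Subset N
    u v x y : Fin N

x∈p─q⁻ : ∀ (p q : Subset N) → x ∈ p ─ q → x ∈ p × x ∉ q
x∈p─q⁻ (inside ∷ p) (outside ∷ q) here = here , λ ()
x∈p─q⁻ {x = zero} (outside ∷ p) (inside ∷ q) ()
x∈p─q⁻ {x = zero} (outside ∷ p) (outside ∷ q) ()
x∈p─q⁻ (_ ∷ p) (_ ∷ q) (there x∈p─q) with x∈p─q⁻ p q x∈p─q
... | x∈p , x∉q = there x∈p , x∉q ∘ drop-there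

x∈p-y⁻ : x ∈ p - y → x ∈ p × x ≢ y
x∈p-y⁻ x∈p-y with x∈p─q⁻ _ _ x∈p-y
... | x∈p , x∉⁅y⁆ = x∈p , x∉⁅y⁆⇒x≢y x∉⁅y⁆

p⊆q⇒p-x⊆q-x : p ⊆ q → p - x ⊆ q - x
p⊆q⇒p-x⊆q-x p⊆q i∈p-x with x∈p-y⁻ i∈p-x
... | i∈p , i≢x = x∈p∧x≢y⇒x∈p-y (p⊆q i∈p) i≢x

p-x-y-z≡p-z-x-y : ∀ (p : Subset N) x y z → p - x - y - z ≡ p - z - x - y
p-x-y-z≡p-z-x-y p x y z = trans (p─x─y≡p─y─x (p - x) y z) (cong (_- y) (p─x─y≡p─y─x p x z))

∣p∣≡1+∣p-x∣ : x ∈ p → ∣ p ∣ ≡ suc ∣ p - x ∣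
∣p∣≡1+∣p-x∣ {p = inside ∷ p} here = cong (suc ∘ ∣_∣) (sym (p─⊥≡p p))
∣p∣≡1+∣p-x∣ {p = inside ∷ p} (there x∈p) = cong suc (∣p∣≡1+∣p-x∣ x∈p)
∣p∣≡1+∣p-x∣ {p = outside ∷ p} (there x∈p) = ∣p∣≡1+∣p-x∣ x∈p

∣p∣≤1+k⇒∣p-x∣≤k : x ∈ p → ∣ p ∣ ≤ suc k → ∣ p - x ∣ ≤ k
∣p∣≤1+k⇒∣p-x∣≤k x∈p ∣p∣≤ = s≤s⁻¹ (subst (_≤ _) (∣p∣≡1+∣p-x∣ x∈p) ∣p∣≤)

∣p∣≤0⇒x∉p : ∣ p ∣ ≤ 0 → x ∉ p
∣p∣≤0⇒x∉p ∣p∣≤0 x∈p = case subst (_≤ 0) (∣p∣≡1+∣p-x∣ x∈p) ∣p∣≤0 of λ ()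

nonempty-≢⇒⊈ : Nonempty p → p ≢ ⁅ x ⁆ → ¬ p ⊆ ⁅ x ⁆
nonempty-≢⇒⊈ {p = p} (z , z∈p) p≢⁅x⁆ p⊆⁅x⁆ = p≢⁅x⁆ (⊆-antisym p⊆⁅x⁆ ⁅x⁆⊆p)
  where
  ⁅x⁆⊆p : ⁅ _ ⁆ ⊆ p
  ⁅x⁆⊆p i∈⁅x⁆ = subst (_∈ p) (trans (x∈⁅y⁆⇒x≡y _ (p⊆⁅x⁆ z∈p)) (sym (x∈⁅y⁆⇒x≡y _ i∈⁅x⁆))) z∈p

isEmpty⁻ : isEmpty p ≡ true → x ∉ p
isEmpty⁻ {p = outside ∷ p} empty (there x∈p) = isEmpty⁻ empty x∈p

isEmpty⁺ : (∀ {x} → x ∉ p) → isEmpty p ≡ true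
isEmpty⁺ {p = []} _ = refl
isEmpty⁺ {p = inside ∷ p} ∉p = ⊥-elim (∉p here)
isEmpty⁺ {p = outside ∷ p} ∉p = isEmpty⁺ (∉p ∘ there)

disjoint⁻ : disjoint p q ≡ true → x ∈ p → x ∉ q
disjoint⁻ disj x∈p x∈q = isEmpty⁻ disj (x∈p∩q⁺ (x∈p , x∈q))

disjoint⁺ : (∀ {x} → x ∈ p → x ∉ q) → disjoint p q ≡ true
disjoint⁺ {p = p} {q} p∩q≡∅ = isEmpty⁺ λ x∈p∩q → let x∈p , x∈q = x∈p∩q⁻ p q x∈p∩q in p∩q≡∅ x∈p x∈q

isEmpty[p-x]⇔p⊆⁅x⁆ : isEmpty (p - x) ≡ true ⇔ p ⊆ ⁅ x ⁆
isEmpty[p-x]⇔p⊆⁅x⁆ {p = p} {x} = mk⇔ to from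
  where
  to : isEmpty (p - x) ≡ true → p ⊆ ⁅ x ⁆
  to empty {z} z∈p with z ≟ x
  ... | yes refl = x∈⁅x⁆ z
  ... | no z≢x = ⊥-elim (isEmpty⁻ empty (x∈p∧x≢y⇒x∈p-y z∈p z≢x))
  from : p ⊆ ⁅ x ⁆ → isEmpty (p - x) ≡ true
  from p⊆⁅x⁆ = isEmpty⁺ λ z∈p-x → let z∈p , z∉⁅x⁆ = x∈p─q⁻ p ⁅ x ⁆ z∈p-x in z∉⁅x⁆ (p⊆⁅x⁆ z∈p)

≤R-refl : ∀ {a} → a ≤R a
≤R-refl = ≤-refl

≤R-reflexive : ∀ {a b} → a ≡ b → a ≤R b
≤R-reflexive refl = ≤R-refl

≤R-trans : ∀ {a b c} → a ≤R b → b ≤R c → a ≤R c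
≤R-trans = ≤-trans

≤R-lwin : ∀ a → a ≤R lwin
≤R-lwin rwin = z≤n
≤R-lwin draw = s≤s z≤n
≤R-lwin lwin = ≤-refl

rank-maxR : ∀ a b → rank (maxR a b) ≡ rank a ⊔ rank b
rank-maxR rwin rwin = refl
rank-maxR rwin draw = refl
rank-maxR rwin lwin = refl
rank-maxR draw rwin = refl
rank-maxR draw draw = refl
rank-maxR draw lwin = refl
rank-maxR lwin rwin = refl
rank-maxR lwin draw = refl
rank-maxR lwin lwin = refl

rank-minR : ∀ a b → rank (minR a b) ≡ rank a ⊓ rank b
rank-minR rwin rwin = refl
rank-minR rwin draw = refl
rank-minR rwin lwin = refl
rank-minR draw rwin = refl
rank-minR draw draw = refl
rank-minR draw lwin = refl
rank-minR lwin rwin = refl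
rank-minR lwin draw = refl
rank-minR lwin lwin = refl

maxR-upperˡ : ∀ a b → a ≤R maxR a b
maxR-upperˡ a b = ≤-trans (m≤m⊔n (rank a) (rank b)) (≤-reflexive (sym (rank-maxR a b)))

maxR-upperʳ : ∀ a b → b ≤R maxR a b
maxR-upperʳ a b = ≤-trans (m≤n⊔m (rank a) (rank b)) (≤-reflexive (sym (rank-maxR a b)))

maxR-least : ∀ {a b c} → a ≤R c → b ≤R c → maxR a b ≤R c
maxR-least {a} {b} a≤c b≤c = ≤-trans (≤-reflexive (rank-maxR a b)) (⊔-lub a≤c b≤c)

minR-lowerˡ : ∀ a b → minR a b ≤R a
minR-lowerˡ a b = ≤-trans (≤-reflexive (rank-minR a b)) (m⊓n≤m (rank a) (rank b))

minR-lowerʳ : ∀ a b → minR a b ≤R b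
minR-lowerʳ a b = ≤-trans (≤-reflexive (rank-minR a b)) (m⊓n≤n (rank a) (rank b))

minR-greatest : ∀ {a b c} → c ≤R a → c ≤R b → c ≤R minR a b
minR-greatest {a} {b} c≤a c≤b = ≤-trans (⊓-glb c≤a c≤b) (≤-reflexive (sym (rank-minR a b)))

module Extremum (_⊑_ : Result → Result → Set) (⊑-refl : ∀ {a} → a ⊑ a)
                (⊑-trans : ∀ {a b c} → a ⊑ b → b ⊑ c → a ⊑ c) (_∙_ : Result → Result → Result)
                (∙-upperˡ : ∀ a b → a ⊑ (a ∙ b)) (∙-upperʳ : ∀ a b → b ⊑ (a ∙ b))
                (∙-least : ∀ {a b c} → a ⊑ c → b ⊑ c → (a ∙ b) ⊑ c)
                {A : Set} {f : A → Result} where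

  private
    init-⊑ : ∀ r xs → r ⊑ foldr _∙_ r (map f xs)
    init-⊑ r [] = ⊑-refl
    init-⊑ r (x ∷ xs) = ⊑-trans (init-⊑ r xs) (∙-upperʳ (f x) _)

    elem-⊑ : ∀ {x} r xs → x ∈ₗ xs → f x ⊑ foldr _∙_ r (map f xs)
    elem-⊑ r (x ∷ xs) (here refl) = ∙-upperˡ (f x) _
    elem-⊑ r (y ∷ xs) (there x∈xs) = ⊑-trans (elem-⊑ r xs x∈xs) (∙-upperʳ (f y) _)

    foldr-⊑ : ∀ {c} r xs → r ⊑ c → (∀ {x} → x ∈ₗ xs → f x ⊑ c) → foldr _∙_ r (map f xs) ⊑ c
    foldr-⊑ r [] r⊑c _ = r⊑c
    foldr-⊑ r (x ∷ xs) r⊑c xs⊑c = ∙-least (xs⊑c (here refl)) (foldr-⊑ r xs r⊑c (xs⊑c ∘ there))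

  bestFor-upper : ∀ {x xs} → x ∈ₗ xs → f x ⊑ bestFor _∙_ (map f xs)
  bestFor-upper {xs = y ∷ ys} (here refl) = init-⊑ (f y) ys
  bestFor-upper {xs = y ∷ ys} (there x∈ys) = elem-⊑ (f y) ys x∈ys

  bestFor-least : ∀ {xs c} → (xs ≡ [] → draw ⊑ c) → (∀ {x} → x ∈ₗ xs → f x ⊑ c) →
                  bestFor _∙_ (map f xs) ⊑ c
  bestFor-least {[]} empty _ = empty refl
  bestFor-least {y ∷ ys} _ ys⊑c = foldr-⊑ (f y) ys (ys⊑c (here refl)) (ys⊑c ∘ there)

open Extremum _≤R_ ≤R-refl ≤R-trans maxR maxR-upperˡ maxR-upperʳ maxR-least
  renaming (bestFor-upper to ≤-max; bestFor-least to max-≤)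

open Extremum (λ a b → b ≤R a) ≤R-refl (λ p q → ≤R-trans q p) minR minR-lowerˡ minR-lowerʳ minR-greatest
  renaming (bestFor-upper to min-≤; bestFor-least to ≤-min)

neg : Result → Result
neg rwin = lwin
neg draw = draw
neg lwin = rwin

neg-involutive : ∀ a → neg (neg a) ≡ a
neg-involutive rwin = refl
neg-involutive draw = refl
neg-involutive lwin = refl

rank-neg : ∀ a → rank (neg a) ≡ 2 ∸ rank a
rank-neg rwin = refl
rank-neg draw = refl
rank-neg lwin = refl

neg-antitone : ∀ {a b} → a ≤R b → neg b ≤R neg a
neg-antitone {a} {b} a≤b =
  ≤-trans (≤-reflexive (rank-neg b)) (≤-trans (∸-monoʳ-≤ 2 a≤b) (≤-reflexive (sym (rank-neg a))))

neg-maxR : ∀ a b → neg (maxR a b) ≡ minR (neg a) (neg b)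
neg-maxR rwin rwin = refl
neg-maxR rwin draw = refl
neg-maxR rwin lwin = refl
neg-maxR draw rwin = refl
neg-maxR draw draw = refl
neg-maxR draw lwin = refl
neg-maxR lwin rwin = refl
neg-maxR lwin draw = refl
neg-maxR lwin lwin = refl

neg-minR : ∀ a b → neg (minR a b) ≡ maxR (neg a) (neg b)
neg-minR a b = begin
  neg (minR a b)                         ≡⟨ cong neg (cong₂ minR (neg-involutive a) (neg-involutive b)) ⟨
  neg (minR (neg (neg a)) (neg (neg b))) ≡⟨ cong neg (neg-maxR (neg a) (neg b)) ⟨
  neg (neg (maxR (neg a) (neg b)))       ≡⟨ neg-involutive _ ⟩
  maxR (neg a) (neg b)                   ∎
  where open ≡-Reasoning

neg-bestFor : ∀ {_∙_ _∘_ : Result → Result → Result} → (∀ a b → neg (a ∙ b) ≡ neg a ∘ neg b) →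
              ∀ rs → neg (bestFor _∙_ rs) ≡ bestFor _∘_ (map neg rs)
neg-bestFor homo [] = refl
neg-bestFor {_∙_} {_∘_} homo (r ∷ rs) = neg-foldr rs
  where
  neg-foldr : ∀ rs → neg (foldr _∙_ r rs) ≡ foldr _∘_ (neg r) (map neg rs)
  neg-foldr [] = refl
  neg-foldr (a ∷ rs) = trans (homo a _) (cong (neg a ∘_) (neg-foldr rs))

dual : Game N → Game N
dual G = game (V G) (ER G) (EL G)

dual-after : ∀ (S T : Subset N) G → dual (after S T G) ≡ after T S (dual G)
dual-after S T G = cong (λ W → game (V G ─ W) (minus (plus (ER G) T) S) (minus (plus (EL G) S) T)) (∪-comm S T)

V-L : ∀ (G : Game N) x → V (G L[ x ]) ≡ V G - x
V-L G x = cong (V G ─_) (∪-identityʳ ⁅ x ⁆)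

V-R : ∀ (G : Game N) x → V (G R[ x ]) ≡ V G - x
V-R G x = cong (V G ─_) (∪-identityˡ ⁅ x ⁆)

∈-V-L⁺ : ∀ (G : Game N) x {y} → y ∈ V G → y ≢ x → y ∈ V (G L[ x ])
∈-V-L⁺ G x y∈V y≢x = subst (_ ∈_) (sym (V-L G x)) (x∈p∧x≢y⇒x∈p-y y∈V y≢x)

∈-V-L⁻ : ∀ (G : Game N) x {y} → y ∈ V (G L[ x ]) → y ∈ V G × y ≢ x
∈-V-L⁻ G x y∈ = x∈p-y⁻ (subst (_ ∈_) (V-L G x) y∈)

∈-V-R⁺ : ∀ (G : Game N) x {y} → y ∈ V G → y ≢ x → y ∈ V (G R[ x ])
∈-V-R⁺ G x y∈V y≢x = subst (_ ∈_) (sym (V-R G x)) (x∈p∧x≢y⇒x∈p-y y∈V y≢x)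

∈-V-R⁻ : ∀ (G : Game N) x {y} → y ∈ V (G R[ x ]) → y ∈ V G × y ≢ x
∈-V-R⁻ G x y∈ = x∈p-y⁻ (subst (_ ∈_) (V-R G x) y∈)

∣V-L∣≤ : ∀ (G : Game N) {x k} → x ∈ V G → ∣ V G ∣ ≤ suc k → ∣ V (G L[ x ]) ∣ ≤ k
∣V-L∣≤ G {x} {k} x∈V fuel = subst (λ W → ∣ W ∣ ≤ k) (sym (V-L G x)) (∣p∣≤1+k⇒∣p-x∣≤k x∈V fuel)

∣V-R∣≤ : ∀ (G : Game N) {x k} → x ∈ V G → ∣ V G ∣ ≤ suc k → ∣ V (G R[ x ]) ∣ ≤ k
∣V-R∣≤ G {x} {k} x∈V fuel = subst (λ W → ∣ W ∣ ≤ k) (sym (V-R G x)) (∣p∣≤1+k⇒∣p-x∣≤k x∈V fuel)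

∈-moves⁺ : x ∈ V G → x ∈ₗ moves G
∈-moves⁺ {x = x} {G = G} x∈V = ∈-filter⁺ (λ x → lookup (V G) x ≟B true) (∈-allFin x) ([]=⇒lookup x∈V)

∈-moves⁻ : x ∈ₗ moves G → x ∈ V G
∈-moves⁻ {x = x} {G = G} x∈moves =
  lookup⇒[]= x (V G) (proj₂ (∈-filter⁻ (λ x → lookup (V G) x ≟B true) {xs = allFin _} x∈moves))

moves-[] : (∀ {x} → x ∉ V G) → moves G ≡ []
moves-[] {G = G} ∉V with moves G in eq
... | [] = refl
... | x ∷ _ = ⊥-elim (∉V (∈-moves⁻ {G = G} (subst (x ∈ₗ_) (sym eq) (here refl))))

moves-[]⁻ : moves G ≡ [] → x ∉ V G
moves-[]⁻ {G = G} eq x∈V = case subst (_ ∈ₗ_) eq (∈-moves⁺ {G = G} x∈V) of λ ()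

∈-minus⁻ : ∀ {f} {T : Subset N} → f ∈ₗ minus E T → f ∈ₗ E × (∀ {i} → i ∈ f → i ∉ T)
∈-minus⁻ {T = T} f∈ with ∈-filter⁻ (λ e → disjoint e T ≟B true) f∈
... | f∈E , disj = f∈E , disjoint⁻ disj

∈-minus⁺ : ∀ {f} {T : Subset N} → f ∈ₗ E → (∀ {i} → i ∈ f → i ∉ T) → f ∈ₗ minus E T
∈-minus⁺ {T = T} f∈E f∩T≡∅ = ∈-filter⁺ (λ e → disjoint e T ≟B true) f∈E (disjoint⁺ f∩T≡∅)

∈-plus-⊥⁻ : ∀ {f} → f ∈ₗ plus E ⊥ → f ∈ₗ E
∈-plus-⊥⁻ {E = E} f∈ with ∈-map⁻ (_─ ⊥) f∈
... | e , e∈E , refl = subst (_∈ₗ E) (sym (p─⊥≡p e)) e∈E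

∈-plus-⊥⁺ : ∀ {f} → f ∈ₗ E → f ∈ₗ plus E ⊥
∈-plus-⊥⁺ {f = f} f∈E = subst (_∈ₗ _) (p─⊥≡p f) (∈-map⁺ (_─ ⊥) f∈E)

∈-EL-L⁻ : ∀ (G : Game N) x {f} → f ∈ₗ EL (G L[ x ]) → ∃ λ e → e ∈ₗ EL G × f ≡ e - x
∈-EL-L⁻ G x f∈ = ∈-map⁻ (_- x) (proj₁ (∈-minus⁻ f∈))

∈-EL-L⁺ : ∀ (G : Game N) x {e} → e ∈ₗ EL G → e - x ∈ₗ EL (G L[ x ])
∈-EL-L⁺ G x e∈ = ∈-minus⁺ (∈-map⁺ (_- x) e∈) λ _ → ∉⊥

∈-ER-L⁻ : ∀ (G : Game N) x {g} → g ∈ₗ ER (G L[ x ]) → g ∈ₗ ER G × x ∉ g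
∈-ER-L⁻ G x g∈ with ∈-minus⁻ g∈
... | g∈⁺ , g∩⁅x⁆≡∅ = ∈-plus-⊥⁻ g∈⁺ , λ x∈g → g∩⁅x⁆≡∅ x∈g (x∈⁅x⁆ x)

∈-ER-L⁺ : ∀ (G : Game N) x {g} → g ∈ₗ ER G → x ∉ g → g ∈ₗ ER (G L[ x ])
∈-ER-L⁺ G x {g} g∈ x∉g = ∈-minus⁺ (∈-plus-⊥⁺ g∈) λ i∈g i∈⁅x⁆ → x∉g (subst (_∈ g) (x∈⁅y⁆⇒x≡y _ i∈⁅x⁆) i∈g)

-- The edges of G R[ y ] are those of (dual G) L[ y ], with the colours exchanged.
∈-ER-R⁻ : ∀ (G : Game N) y {g} → g ∈ₗ ER (G R[ y ]) → ∃ λ e → e ∈ₗ ER G × g ≡ e - y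
∈-ER-R⁻ G = ∈-EL-L⁻ (dual G)

∈-ER-R⁺ : ∀ (G : Game N) y {e} → e ∈ₗ ER G → e - y ∈ₗ ER (G R[ y ])
∈-ER-R⁺ G = ∈-EL-L⁺ (dual G)

∈-EL-R⁻ : ∀ (G : Game N) y {f} → f ∈ₗ EL (G R[ y ]) → f ∈ₗ EL G × y ∉ f
∈-EL-R⁻ G = ∈-ER-L⁻ (dual G)

∈-EL-R⁺ : ∀ (G : Game N) y {f} → f ∈ₗ EL G → y ∉ f → f ∈ₗ EL (G R[ y ])
∈-EL-R⁺ G = ∈-ER-L⁺ (dual G)

Dominated : Fin N → Fin N → List (Subset N) → Set
Dominated u v E = ∀ {e} → e ∈ₗ E → u ∈ e → v ∈ e

Dominated-after : ∀ {S T : Subset N} → v ∉ S → Dominated u v E → Dominated u v (minus (plus E S) T)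
Dominated-after {S = S} v∉S dom e∈ u∈e with ∈-map⁻ (_─ S) (proj₁ (∈-minus⁻ e∈))
... | e , e∈E , refl = x∈p∧x∉q⇒x∈p─q (dom e∈E (p─q⊆p _ _ u∈e)) v∉S

Completes : List (Subset N) → Fin N → Set
Completes E x = ∃ λ e → e ∈ₗ E × e ⊆ ⁅ x ⁆

completes? : List (Subset N) → Fin N → Bool
completes? E x = any (λ e → isEmpty (e ─ ⁅ x ⁆)) E

completes⁻ : completes? E x ≡ true → Completes E x
completes⁻ eq with find (any⁻ _ _ (Equivalence.from T-≡ eq))
... | e , e∈E , empty = e , e∈E , Equivalence.to isEmpty[p-x]⇔p⊆⁅x⁆ (Equivalence.to T-≡ empty)

completes⁺ : Completes E x → completes? E x ≡ true
completes⁺ (e , e∈E , e⊆⁅x⁆) =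
  Equivalence.to T-≡ (any⁺ _ (lose e∈E (Equivalence.from T-≡ (Equivalence.from isEmpty[p-x]⇔p⊆⁅x⁆ e⊆⁅x⁆))))

-- By definition, value (suc k) Left G = bestFor maxR (map (leftMoveValue k G) (moves G)),
-- and dually for Right.
leftMoveValue : ℕ → Game N → Fin N → Result
leftMoveValue k G x = if completes? (EL G) x then lwin else value k Right (G L[ x ])

rightMoveValue : ℕ → Game N → Fin N → Result
rightMoveValue k G x = if completes? (ER G) x then rwin else value k Left (G R[ x ])

value-empty : ∀ k p → (∀ {x} → x ∉ V G) → value k p G ≡ draw
value-empty zero p ∉V = refl
value-empty {G = G} (suc k) Left ∉V = cong (bestFor maxR ∘ map (leftMoveValue k G)) (moves-[] {G = G} ∉V)
value-empty {G = G} (suc k) Right ∉V = cong (bestFor minR ∘ map (rightMoveValue k G)) (moves-[] {G = G} ∉V)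

leftMoveValue-continues : ¬ Completes (EL G) x → leftMoveValue k G x ≡ value k Right (G L[ x ])
leftMoveValue-continues {G = G} {x} ¬c with completes? (EL G) x in eq
... | true = ⊥-elim (¬c (completes⁻ eq))
... | false = refl

rightMoveValue-continues : ¬ Completes (ER G) x → rightMoveValue k G x ≡ value k Left (G R[ x ])
rightMoveValue-continues {G = G} {x} ¬c with completes? (ER G) x in eq
... | true = ⊥-elim (¬c (completes⁻ eq))
... | false = refl

value≤leftMoveValue : value k Right (G L[ x ]) ≤R leftMoveValue k G x
value≤leftMoveValue {G = G} {x} with completes? (EL G) x
... | true = ≤R-lwin _
... | false = ≤R-refl

leftMoveValue-mono : ∀ {k k′} {H H' : Game N} {x y} → (Completes (EL H) x → Completes (EL H') y) →
                     (¬ Completes (EL H) x → value k Right (H L[ x ]) ≤R value k′ Right (H' L[ y ])) →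
                     leftMoveValue k H x ≤R leftMoveValue k′ H' y
leftMoveValue-mono {k = k} {H = H} {H'} {x} {y} transfer continue with completes? (EL H') y in eq
... | true = ≤R-lwin _
... | false = subst (_≤R _) (sym (leftMoveValue-continues {G = H} {x} {k} ¬c)) (continue ¬c)
  where
  ¬c = λ c → case trans (sym (completes⁺ (transfer c))) eq of λ ()

rightMoveValue-mono : ∀ {k k′} {H H' : Game N} {x y} → (Completes (ER H') y → Completes (ER H) x) →
                      (¬ Completes (ER H) x → value k Left (H R[ x ]) ≤R value k′ Left (H' R[ y ])) →
                      rightMoveValue k H x ≤R rightMoveValue k′ H' y
rightMoveValue-mono {k′ = k′} {H} {H'} {x} {y} transfer continue with completes? (ER H) x in eq
... | true = z≤n
... | false = subst (_ ≤R_) (sym (rightMoveValue-continues {G = H'} {y} {k′} (¬c ∘ transfer))) (continue ¬c)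
  where
  ¬c = λ c → case trans (sym (completes⁺ c)) eq of λ ()

-- Exchanging the colours

opponent : Player → Player
opponent Left = Right
opponent Right = Left

value-dual : ∀ k p (G : Game N) → value k p (dual G) ≡ neg (value k (opponent p) G)
value-dual zero p G = refl
value-dual (suc k) Left G = begin
  bestFor maxR (map (leftMoveValue k (dual G)) (moves G)) ≡⟨ cong (bestFor maxR) (map-cong step (moves G)) ⟩
  bestFor maxR (map (neg ∘ rightMoveValue k G) (moves G)) ≡⟨ cong (bestFor maxR) (map-∘ (moves G)) ⟩
  bestFor maxR (map neg rs)                               ≡⟨ neg-bestFor {_∙_ = minR} {maxR} neg-minR rs ⟨
  neg (bestFor minR rs)                                   ∎
  where
  open ≡-Reasoning
  rs = map (rightMoveValue k G) (moves G)
  step : ∀ x → leftMoveValue k (dual G) x ≡ neg (rightMoveValue k G x)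
  step x with completes? (ER G) x
  ... | true = refl
  ... | false = trans (cong (value k Right) (sym (dual-after ⊥ ⁅ x ⁆ G))) (value-dual k Right (G R[ x ]))
value-dual (suc k) Right G = begin
  bestFor minR (map (rightMoveValue k (dual G)) (moves G)) ≡⟨ cong (bestFor minR) (map-cong step (moves G)) ⟩
  bestFor minR (map (neg ∘ leftMoveValue k G) (moves G))   ≡⟨ cong (bestFor minR) (map-∘ (moves G)) ⟩
  bestFor minR (map neg rs)                                ≡⟨ neg-bestFor {_∙_ = maxR} {minR} neg-maxR rs ⟨
  neg (bestFor maxR rs)                                    ∎
  where
  open ≡-Reasoning
  rs = map (leftMoveValue k G) (moves G)
  step : ∀ x → rightMoveValue k (dual G) x ≡ neg (leftMoveValue k G x)
  step x with completes? (EL G) x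
  ... | true = refl
  ... | false = trans (cong (value k Left) (sym (dual-after ⁅ x ⁆ ⊥ G))) (value-dual k Left (G L[ x ]))

≤R-by-dual : ∀ p k k′ (H H' : Game N) → value k p (dual H') ≤R value k′ p (dual H) →
             value k′ (opponent p) H ≤R value k (opponent p) H'
≤R-by-dual p k k′ H H' le =
  subst₂ _≤R_ (neg-involutive _) (neg-involutive _)
    (neg-antitone (subst₂ _≤R_ (value-dual k p H') (value-dual k′ p H) le))

≤L-by-dual : {H H' : Game N} → o (dual H') ≤L o (dual H) → o H ≤L o H'
≤L-by-dual {H = H} {H'} (left , right) =
  ≤R-by-dual Right (∣ V H' ∣) (∣ V H ∣) H H' right , ≤R-by-dual Left (∣ V H' ∣) (∣ V H ∣) H H' left

-- Simulation along a relabelling of the vertices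

infix 4 _⊆⟨_⟩_
_⊆⟨_⟩_ : Subset N → (Fin N → Fin N) → Subset N → Set
p ⊆⟨ φ ⟩ q = ∀ {i} → i ∈ p → φ i ∈ q

-- Up to the relabelling π, H' is H with shrunk blue and enlarged red edges,
-- so H' is at least as good for Left (simulation-Left).
record Simulation (π : Permutation′ N) (H H' : Game N) : Set where
  field
    forth : ∀ {x} → x ∈ V H → π ⟨$⟩ʳ x ∈ V H'
    back  : ∀ {y} → y ∈ V H' → π ⟨$⟩ˡ y ∈ V H
    blue  : ∀ {f} → f ∈ₗ EL H → ∃ λ f' → f' ∈ₗ EL H' × f' ⊆⟨ π ⟨$⟩ˡ_ ⟩ f
    red   : ∀ {g'} → g' ∈ₗ ER H' → ∃ λ g → g ∈ₗ ER H × g ⊆⟨ π ⟨$⟩ʳ_ ⟩ g'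

module _ {π : Permutation′ N} where

  private
    σ τ : Fin N → Fin N
    σ = π ⟨$⟩ʳ_
    τ = π ⟨$⟩ˡ_

    σ-injective : ∀ {x y} → σ x ≡ σ y → x ≡ y
    σ-injective {x} {y} eq = trans (sym (inverseˡ π {x})) (trans (cong τ eq) (inverseˡ π {y}))

    τ≡⇒≡σ : ∀ {x y} → τ y ≡ x → y ≡ σ x
    τ≡⇒≡σ {x} {y} eq = trans (sym (inverseʳ π {y})) (cong σ eq)

  Simulation-dual : Simulation π H H' → Simulation (flip π) (dual H') (dual H)
  Simulation-dual r = record { forth = back ; back = forth ; blue = red ; red = blue }
    where open Simulation r

  Simulation-L : Simulation π H H' → ∀ x → Simulation π (H L[ x ]) (H' L[ σ x ])
  Simulation-L {H = H} {H'} r x = record { forth = forth′ ; back = back′ ; blue = blue′ ; red = red′ }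
    where
    open Simulation r
    forth′ : ∀ {z} → z ∈ V (H L[ x ]) → σ z ∈ V (H' L[ σ x ])
    forth′ z∈ with ∈-V-L⁻ H x z∈
    ... | z∈V , z≢x = ∈-V-L⁺ H' (σ x) (forth z∈V) (z≢x ∘ σ-injective)
    back′ : ∀ {z} → z ∈ V (H' L[ σ x ]) → τ z ∈ V (H L[ x ])
    back′ z∈ with ∈-V-L⁻ H' (σ x) z∈
    ... | z∈V , z≢σx = ∈-V-L⁺ H x (back z∈V) (z≢σx ∘ τ≡⇒≡σ)
    blue′ : ∀ {f} → f ∈ₗ EL (H L[ x ]) → ∃ λ f' → f' ∈ₗ EL (H' L[ σ x ]) × f' ⊆⟨ τ ⟩ f
    blue′ f∈ with ∈-EL-L⁻ H x f∈
    ... | e , e∈ , refl with blue e∈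
    ... | f' , f'∈ , f'⊆e = f' - σ x , ∈-EL-L⁺ H' (σ x) f'∈ , λ i∈ →
      let i∈f' , i≢σx = x∈p-y⁻ i∈ in x∈p∧x≢y⇒x∈p-y (f'⊆e i∈f') (i≢σx ∘ τ≡⇒≡σ)
    red′ : ∀ {g'} → g' ∈ₗ ER (H' L[ σ x ]) → ∃ λ g → g ∈ₗ ER (H L[ x ]) × g ⊆⟨ σ ⟩ g'
    red′ g'∈ with ∈-ER-L⁻ H' (σ x) g'∈
    ... | g'∈ER , σx∉g' with red g'∈ER
    ... | g , g∈ , g⊆g' = g , ∈-ER-L⁺ H x g∈ (σx∉g' ∘ g⊆g') , g⊆g'

  Simulation-completes : Simulation π H H' → Completes (EL H) x → Completes (EL H') (σ x)
  Simulation-completes r (e , e∈ , e⊆⁅x⁆) with Simulation.blue r e∈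
  ... | f' , f'∈ , f'⊆e = f' , f'∈ , λ i∈ →
    subst (_∈ ⁅ σ _ ⁆) (sym (τ≡⇒≡σ (x∈⁅y⁆⇒x≡y _ (e⊆⁅x⁆ (f'⊆e i∈))))) (x∈⁅x⁆ _)

simulation-Left : ∀ k {π : Permutation′ N} {H H'} → Simulation π H H' → value k Left H ≤R value k Left H'
simulation-Left zero r = ≤R-refl {draw}
simulation-Left (suc k) {π} {H} {H'} r = max-≤ no-moves bound
  where
  open Simulation r
  no-moves : moves H ≡ [] → draw ≤R value (suc k) Left H'
  no-moves eq = ≤R-reflexive (sym (value-empty {G = H'} (suc k) Left (moves-[]⁻ {G = H} eq ∘ back)))
  bound : ∀ {x} → x ∈ₗ moves H → leftMoveValue k H x ≤R value (suc k) Left H'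
  bound {x} x∈ = ≤R-trans
    (leftMoveValue-mono {k = k} {k} {H} {H'} {x} {π ⟨$⟩ʳ x} (Simulation-completes r) λ _ →
      -- Right's turn: exchanging the colours reverses the simulation.
      ≤R-by-dual Left k k (H L[ x ]) (H' L[ π ⟨$⟩ʳ x ]) (simulation-Left k (Simulation-dual (Simulation-L r x))))
    (≤-max (∈-moves⁺ {G = H'} (forth (∈-moves⁻ {G = H} x∈))))

simulation : ∀ k p {π : Permutation′ N} {H H'} → Simulation π H H' → value k p H ≤R value k p H'
simulation k Left r = simulation-Left k r
simulation k Right {H = H} {H'} r = ≤R-by-dual Left k k H H' (simulation-Left k (Simulation-dual r))

≤L-by-fuel : ∀ {m n} {H H' : Game N} → (∀ p → value m p H ≤R value n p H') →
             ∣ V H ∣ ≡ m → ∣ V H' ∣ ≡ n → o H ≤L o H'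
≤L-by-fuel le refl refl = le Left , le Right

-- Picking u versus picking v

transpose-matchʳ : ∀ (i j : Fin N) → PC.transpose i j j ≡ i
transpose-matchʳ i j with j ≟ i
... | yes refl = refl
... | no j≢i rewrite dec-true (j ≟ j) refl = refl

transpose-other : ∀ {i j k : Fin N} → k ≢ i → k ≢ j → PC.transpose i j k ≡ k
transpose-other {i = i} {j} {k} k≢i k≢j rewrite dec-false (k ≟ i) k≢i | dec-false (k ≟ j) k≢j = refl

pick-simulation : u ≢ v → u ∈ V G → v ∈ V G → Dominated u v (EL G) → Dominated u v (ER G) →
                  Simulation (transpose u v) (G L[ u ]) (G L[ v ])
pick-simulation {u = u} {v} {G} u≢v u∈V v∈V domL domR =
  record { forth = forth ; back = back ; blue = blue ; red = red }
  where
  σ τ : Fin _ → Fin _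
  σ = PC.transpose u v
  τ = PC.transpose v u
  forth : ∀ {x} → x ∈ V (G L[ u ]) → σ x ∈ V (G L[ v ])
  forth {x} x∈ with ∈-V-L⁻ G u x∈ | x ≟ v
  ... | _ | yes refl rewrite transpose-matchʳ u v = ∈-V-L⁺ G v u∈V u≢v
  ... | x∈V , x≢u | no x≢v rewrite transpose-other x≢u x≢v = ∈-V-L⁺ G v x∈V x≢v
  back : ∀ {y} → y ∈ V (G L[ v ]) → τ y ∈ V (G L[ u ])
  back {y} y∈ with ∈-V-L⁻ G v y∈ | y ≟ u
  ... | _ | yes refl rewrite transpose-matchʳ v u = ∈-V-L⁺ G u v∈V (u≢v ∘ sym)
  ... | y∈V , y≢v | no y≢u rewrite transpose-other y≢v y≢u = ∈-V-L⁺ G u y∈V y≢u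
  blue : ∀ {f} → f ∈ₗ EL (G L[ u ]) → ∃ λ f' → f' ∈ₗ EL (G L[ v ]) × f' ⊆⟨ τ ⟩ f
  blue f∈ with ∈-EL-L⁻ G u f∈
  ... | e , e∈ , refl = e - v , ∈-EL-L⁺ G v e∈ , moved
    where
    moved : e - v ⊆⟨ τ ⟩ (e - u)
    moved {i} i∈ with x∈p-y⁻ i∈ | i ≟ u
    ... | i∈e , _ | yes refl rewrite transpose-matchʳ v i = x∈p∧x≢y⇒x∈p-y (domL e∈ i∈e) (u≢v ∘ sym)
    ... | i∈e , i≢v | no i≢u rewrite transpose-other i≢v i≢u = x∈p∧x≢y⇒x∈p-y i∈e i≢u
  red : ∀ {g'} → g' ∈ₗ ER (G L[ v ]) → ∃ λ g → g ∈ₗ ER (G L[ u ]) × g ⊆⟨ σ ⟩ g'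
  red {g'} g'∈ with ∈-ER-L⁻ G v g'∈
  ... | g'∈ER , v∉g' = g' , ∈-ER-L⁺ G u g'∈ER u∉g' , fixed
    where
    u∉g' : u ∉ g'
    u∉g' = v∉g' ∘ domR g'∈ER
    fixed : g' ⊆⟨ σ ⟩ g'
    fixed {i} i∈ rewrite transpose-other {i = u} {v} {i} (λ { refl → u∉g' i∈ }) (λ { refl → v∉g' i∈ }) = i∈

o-L[u]≤o-L[v] : u ∈ V G → v ∈ V G → Dominated u v (EL G) → Dominated u v (ER G) →
                o (G L[ u ]) ≤L o (G L[ v ])
o-L[u]≤o-L[v] {u = u} {G} {v} u∈V v∈V domL domR with u ≟ v
... | yes refl = ≤R-refl , ≤R-refl
... | no u≢v = ≤L-by-fuel {H = G L[ u ]} {G L[ v ]}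
  (λ p → simulation (∣ V (G L[ u ]) ∣) p (pick-simulation u≢v u∈V v∈V domL domR)) refl
  (suc-injective (begin
    suc ∣ V (G L[ v ]) ∣ ≡⟨ cong (suc ∘ ∣_∣) (V-L G v) ⟩
    suc ∣ V G - v ∣     ≡⟨ ∣p∣≡1+∣p-x∣ v∈V ⟨
    ∣ V G ∣             ≡⟨ ∣p∣≡1+∣p-x∣ u∈V ⟩
    suc ∣ V G - u ∣     ≡⟨ cong (suc ∘ ∣_∣) (V-L G u) ⟨
    suc ∣ V (G L[ u ]) ∣ ∎))
  where open ≡-Reasoning

-- Pairing u with v

reply≤rightMoveValue : ∀ {k} {G : Game N} {a b} → ¬ Completes (ER G) a → b ∈ V (G R[ a ]) →
                       value k Right ((G R[ a ]) L[ b ]) ≤R rightMoveValue (suc k) G a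
reply≤rightMoveValue {k = k} {G} {a} {b} ¬c b∈V =
  subst (value k Right ((G R[ a ]) L[ b ]) ≤R_) (sym (rightMoveValue-continues {G = G} {a} {suc k} ¬c))
    (≤R-trans (value≤leftMoveValue {k = k} {G = G R[ a ]} {b}) (≤-max (∈-moves⁺ {G = G R[ a ]} b∈V)))

module Pairing {N : ℕ} {u v : Fin N} (u≢v : u ≢ v) where

  -- H is a position of the game in which Left holds u and Right holds v,
  -- H' the corresponding position of the game in which u and v are still free.
  record Paired (H H' : Game N) : Set where
    field
      vertices : V H ≡ V H' - u - v
      u∈V      : u ∈ V H'
      v∈V      : v ∈ V H'
      blue     : ∀ {f} → f ∈ₗ EL H → ∃ λ f' → f' ∈ₗ EL H' × v ∉ f' × f' ⊆ f
      red      : ∀ {g'} → g' ∈ₗ ER H' → u ∉ g' → ∃ λ g → g ∈ₗ ER H × v ∉ g × g ⊆ g'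
      blue-dom : Dominated u v (EL H')
      red-dom  : Dominated u v (ER H')
      red-⊈v   : ∀ {g'} → g' ∈ₗ ER H' → ¬ g' ⊆ ⁅ v ⁆

  Paired-init : ∀ {G : Game N} → u ∈ V G → v ∈ V G → Dominated u v (EL G) → Dominated u v (ER G) →
                (∀ {g} → g ∈ₗ ER G → ¬ g ⊆ ⁅ v ⁆) → Paired (G LR[ u , v ]) G
  Paired-init {G} u∈V v∈V domL domR red-⊈v = record
    { vertices = sym (p─q─r≡p─q∪r (V G) ⁅ u ⁆ ⁅ v ⁆)
    ; u∈V = u∈V ; v∈V = v∈V ; blue = blue ; red = red
    ; blue-dom = domL ; red-dom = domR ; red-⊈v = red-⊈v
    }
    where
    blue : ∀ {f} → f ∈ₗ EL (G LR[ u , v ]) → ∃ λ f' → f' ∈ₗ EL G × v ∉ f' × f' ⊆ f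
    blue f∈ with ∈-minus⁻ f∈
    ... | f∈⁺ , f∩⁅v⁆≡∅ with ∈-map⁻ (_- u) f∈⁺
    ... | e , e∈ , refl = e , e∈ , v∉e , λ i∈e → x∈p∧x≢y⇒x∈p-y i∈e λ { refl → v∉e (domL e∈ i∈e) }
      where
      v∉e : v ∉ e
      v∉e v∈e = f∩⁅v⁆≡∅ (x∈p∧x≢y⇒x∈p-y v∈e (u≢v ∘ sym)) (x∈⁅x⁆ v)
    red : ∀ {g'} → g' ∈ₗ ER G → u ∉ g' → ∃ λ g → g ∈ₗ ER (G LR[ u , v ]) × v ∉ g × g ⊆ g'
    red {g'} g'∈ u∉g' =
      g' - v ,
      ∈-minus⁺ (∈-map⁺ (_- v) g'∈) (λ i∈ i∈⁅u⁆ → u∉g' (subst (_∈ g') (x∈⁅y⁆⇒x≡y _ i∈⁅u⁆) (p─q⊆p _ _ i∈))) ,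
      (λ v∈ → proj₂ (x∈p-y⁻ v∈) refl) ,
      p─q⊆p _ _

  module _ {H H' : Game N} (P : Paired H H') where
    open Paired P

    ∈-V⁻ : ∀ {x} → x ∈ V H → x ∈ V H' × x ≢ u × x ≢ v
    ∈-V⁻ x∈ with x∈p-y⁻ (subst (_ ∈_) vertices x∈)
    ... | x∈V-u , x≢v with x∈p-y⁻ x∈V-u
    ... | x∈V , x≢u = x∈V , x≢u , x≢v

    ∈-V⁺ : ∀ {x} → x ∈ V H' → x ≢ u → x ≢ v → x ∈ V H
    ∈-V⁺ x∈V x≢u x≢v = subst (_ ∈_) (sym vertices) (x∈p∧x≢y⇒x∈p-y (x∈p∧x≢y⇒x∈p-y x∈V x≢u) x≢v)

    completes-L : ∀ {x} → Completes (EL H) x → Completes (EL H') x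
    completes-L (e , e∈ , e⊆⁅x⁆) with blue e∈
    ... | f' , f'∈ , _ , f'⊆e = f' , f'∈ , e⊆⁅x⁆ ∘ f'⊆e

    completes-R : ∀ {y} → y ≢ u → Completes (ER H') y → Completes (ER H) y
    completes-R y≢u (g' , g'∈ , g'⊆⁅y⁆) with red g'∈ (λ u∈ → y≢u (sym (x∈⁅y⁆⇒x≡y _ (g'⊆⁅y⁆ u∈))))
    ... | g , g∈ , _ , g⊆g' = g , g∈ , g'⊆⁅y⁆ ∘ g⊆g'

    -- A red edge inside {u} is empty (an edge through u also contains v), hence inside {v}.
    ¬completes-u : ¬ Completes (ER H') u
    ¬completes-u (g' , g'∈ , g'⊆⁅u⁆) = red-⊈v g'∈ λ i∈ → ⊥-elim (u≢v (sym (x∈⁅y⁆⇒x≡y _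
      (g'⊆⁅u⁆ (red-dom g'∈ (subst (_∈ g') (x∈⁅y⁆⇒x≡y _ (g'⊆⁅u⁆ i∈)) i∈))))))

    ¬completes-v : ¬ Completes (ER H') v
    ¬completes-v (g' , g'∈ , g'⊆⁅v⁆) = red-⊈v g'∈ g'⊆⁅v⁆

    Paired-L : ∀ {x} → x ∈ V H → Paired (H L[ x ]) (H' L[ x ])
    Paired-L {x} x∈ = record
      { vertices = begin
          V (H L[ x ])          ≡⟨ V-L H x ⟩
          V H - x               ≡⟨ cong (_- x) vertices ⟩
          V H' - u - v - x      ≡⟨ p-x-y-z≡p-z-x-y (V H') u v x ⟩
          V H' - x - u - v      ≡⟨ cong (λ W → W - u - v) (V-L H' x) ⟨
          V (H' L[ x ]) - u - v ∎
      ; u∈V = ∈-V-L⁺ H' x u∈V (x≢u ∘ sym)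
      ; v∈V = ∈-V-L⁺ H' x v∈V (x≢v ∘ sym)
      ; blue = blue′ ; red = red′
      ; blue-dom = Dominated-after (x≢y⇒x∉⁅y⁆ (x≢v ∘ sym)) blue-dom
      ; red-dom = Dominated-after ∉⊥ red-dom
      ; red-⊈v = red-⊈v ∘ proj₁ ∘ ∈-ER-L⁻ H' x
      }
      where
      open ≡-Reasoning
      x≢u = proj₁ (proj₂ (∈-V⁻ x∈))
      x≢v = proj₂ (proj₂ (∈-V⁻ x∈))
      blue′ : ∀ {f} → f ∈ₗ EL (H L[ x ]) → ∃ λ f' → f' ∈ₗ EL (H' L[ x ]) × v ∉ f' × f' ⊆ f
      blue′ f∈ with ∈-EL-L⁻ H x f∈
      ... | e , e∈ , refl with blue e∈
      ... | f' , f'∈ , v∉f' , f'⊆e = f' - x , ∈-EL-L⁺ H' x f'∈ , v∉f' ∘ p─q⊆p f' ⁅ x ⁆ , p⊆q⇒p-x⊆q-x f'⊆e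
      red′ : ∀ {g'} → g' ∈ₗ ER (H' L[ x ]) → u ∉ g' → ∃ λ g → g ∈ₗ ER (H L[ x ]) × v ∉ g × g ⊆ g'
      red′ g'∈ u∉g' with ∈-ER-L⁻ H' x g'∈
      ... | g'∈ER , x∉g' with red g'∈ER u∉g'
      ... | g , g∈ , v∉g , g⊆g' = g , ∈-ER-L⁺ H x g∈ (x∉g' ∘ g⊆g') , v∉g , g⊆g'

    Paired-R : ∀ {y} → y ∈ V H → ¬ Completes (ER H) y → Paired (H R[ y ]) (H' R[ y ])
    Paired-R {y} y∈ ¬c = record
      { vertices = begin
          V (H R[ y ])          ≡⟨ V-R H y ⟩
          V H - y               ≡⟨ cong (_- y) vertices ⟩
          V H' - u - v - y      ≡⟨ p-x-y-z≡p-z-x-y (V H') u v y ⟩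
          V H' - y - u - v      ≡⟨ cong (λ W → W - u - v) (V-R H' y) ⟨
          V (H' R[ y ]) - u - v ∎
      ; u∈V = ∈-V-R⁺ H' y u∈V (y≢u ∘ sym)
      ; v∈V = ∈-V-R⁺ H' y v∈V (y≢v ∘ sym)
      ; blue = blue′ ; red = red′
      ; blue-dom = Dominated-after ∉⊥ blue-dom
      ; red-dom = Dominated-after (x≢y⇒x∉⁅y⁆ (y≢v ∘ sym)) red-dom
      ; red-⊈v = red-⊈v′
      }
      where
      open ≡-Reasoning
      y≢u = proj₁ (proj₂ (∈-V⁻ y∈))
      y≢v = proj₂ (proj₂ (∈-V⁻ y∈))
      blue′ : ∀ {f} → f ∈ₗ EL (H R[ y ]) → ∃ λ f' → f' ∈ₗ EL (H' R[ y ]) × v ∉ f' × f' ⊆ f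
      blue′ f∈ with ∈-EL-R⁻ H y f∈
      ... | f∈EL , y∉f with blue f∈EL
      ... | f' , f'∈ , v∉f' , f'⊆f = f' , ∈-EL-R⁺ H' y f'∈ (y∉f ∘ f'⊆f) , v∉f' , f'⊆f
      u∈-y : ∀ {g'} → u ∈ g' → u ∈ g' - y
      u∈-y u∈ = x∈p∧x≢y⇒x∈p-y u∈ (y≢u ∘ sym)
      red′ : ∀ {g'} → g' ∈ₗ ER (H' R[ y ]) → u ∉ g' → ∃ λ g → g ∈ₗ ER (H R[ y ]) × v ∉ g × g ⊆ g'
      red′ g'∈ u∉g' with ∈-ER-R⁻ H' y g'∈
      ... | g' , g'∈ER , refl with red g'∈ER (u∉g' ∘ u∈-y)
      ... | g , g∈ , v∉g , g⊆g' = g - y , ∈-ER-R⁺ H y g∈ , v∉g ∘ p─q⊆p g ⁅ y ⁆ , p⊆q⇒p-x⊆q-x g⊆g'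
      -- A red edge e with e - y ⊆ {v} would give Right the edge e - v ⊆ {y} in H.
      red-⊈v′ : ∀ {g'} → g' ∈ₗ ER (H' R[ y ]) → ¬ g' ⊆ ⁅ v ⁆
      red-⊈v′ g'∈ g'⊆⁅v⁆ with ∈-ER-R⁻ H' y g'∈
      ... | g' , g'∈ER , refl with red g'∈ER (λ u∈ → u≢v (x∈⁅y⁆⇒x≡y _ (g'⊆⁅v⁆ (u∈-y u∈))))
      ... | g , g∈ , v∉g , g⊆g' = ¬c (g , g∈ , g⊆⁅y⁆)
        where
        g⊆⁅y⁆ : g ⊆ ⁅ y ⁆
        g⊆⁅y⁆ {z} z∈g with z ≟ y
        ... | yes refl = x∈⁅x⁆ z
        ... | no z≢y = ⊥-elim (v∉g (subst (_∈ g) (x∈⁅y⁆⇒x≡y _ (g'⊆⁅v⁆ (x∈p∧x≢y⇒x∈p-y (g⊆g' z∈g) z≢y))) z∈g))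

    answer-u : Simulation idₚ H ((H' R[ u ]) L[ v ])
    answer-u = record { forth = subst (_ ∈_) (sym V≡) ; back = subst (_ ∈_) V≡ ; blue = blue′ ; red = red′ }
      where
      V≡ : V ((H' R[ u ]) L[ v ]) ≡ V H
      V≡ = trans (V-L (H' R[ u ]) v) (trans (cong (_- v) (V-R H' u)) (sym vertices))
      blue′ : ∀ {f} → f ∈ₗ EL H → ∃ λ f' → f' ∈ₗ EL ((H' R[ u ]) L[ v ]) × f' ⊆ f
      blue′ f∈ with blue f∈
      ... | f' , f'∈ , v∉f' , f'⊆f =
        f' - v , ∈-EL-L⁺ (H' R[ u ]) v (∈-EL-R⁺ H' u f'∈ (v∉f' ∘ blue-dom f'∈)) , f'⊆f ∘ p─q⊆p f' ⁅ v ⁆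
      red′ : ∀ {g''} → g'' ∈ₗ ER ((H' R[ u ]) L[ v ]) → ∃ λ g → g ∈ₗ ER H × g ⊆ g''
      red′ g''∈ with ∈-ER-L⁻ (H' R[ u ]) v g''∈
      ... | g''∈ER , v∉g'' with ∈-ER-R⁻ H' u g''∈ER
      ... | g' , g'∈ , refl = avoid (red g'∈ u∉g')
        where
        u∉g' : u ∉ g'
        u∉g' = v∉g'' ∘ (λ v∈ → x∈p∧x≢y⇒x∈p-y v∈ (u≢v ∘ sym)) ∘ red-dom g'∈
        avoid : (∃ λ g → g ∈ₗ ER H × v ∉ g × g ⊆ g') → ∃ λ g → g ∈ₗ ER H × g ⊆ g' - u
        avoid (g , g∈ , _ , g⊆g') = g , g∈ , λ i∈ → x∈p∧x≢y⇒x∈p-y (g⊆g' i∈) λ { refl → u∉g' (g⊆g' i∈) }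

    answer-v : Simulation idₚ H ((H' R[ v ]) L[ u ])
    answer-v = record { forth = subst (_ ∈_) (sym V≡) ; back = subst (_ ∈_) V≡ ; blue = blue′ ; red = red′ }
      where
      V≡ : V ((H' R[ v ]) L[ u ]) ≡ V H
      V≡ = trans (V-L (H' R[ v ]) u)
             (trans (cong (_- u) (V-R H' v)) (trans (p─x─y≡p─y─x (V H') v u) (sym vertices)))
      blue′ : ∀ {f} → f ∈ₗ EL H → ∃ λ f' → f' ∈ₗ EL ((H' R[ v ]) L[ u ]) × f' ⊆ f
      blue′ f∈ with blue f∈
      ... | f' , f'∈ , v∉f' , f'⊆f =
        f' - u , ∈-EL-L⁺ (H' R[ v ]) u (∈-EL-R⁺ H' v f'∈ v∉f') , f'⊆f ∘ p─q⊆p f' ⁅ u ⁆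
      red′ : ∀ {g''} → g'' ∈ₗ ER ((H' R[ v ]) L[ u ]) → ∃ λ g → g ∈ₗ ER H × g ⊆ g''
      red′ g''∈ with ∈-ER-L⁻ (H' R[ v ]) u g''∈
      ... | g''∈ER , u∉g'' with ∈-ER-R⁻ H' v g''∈ER
      ... | g' , g'∈ , refl with red g'∈ (u∉g'' ∘ λ u∈ → x∈p∧x≢y⇒x∈p-y u∈ u≢v)
      ... | g , g∈ , v∉g , g⊆g' = g , g∈ , λ i∈ → x∈p∧x≢y⇒x∈p-y (g⊆g' i∈) λ { refl → v∉g i∈ }

    -- With nothing left in H, Left takes v and Right is forced to take u.
    empty-left : ∀ {k} → (∀ {x} → x ∉ V H) → draw ≤R value (suc (suc k)) Left H'
    empty-left {k} ∉V =
      ≤R-trans {draw} draw≤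
        (≤R-trans (value≤leftMoveValue {k = suc k} {G = H'} {v}) (≤-max (∈-moves⁺ {G = H'} v∈V)))
      where
      forced : ∀ {y} → y ∈ₗ moves (H' L[ v ]) → draw ≤R rightMoveValue k (H' L[ v ]) y
      forced {y} y∈ with ∈-V-L⁻ H' v (∈-moves⁻ {G = H' L[ v ]} y∈) | y ≟ u
      ... | y∈V , y≢v | no y≢u = ⊥-elim (∉V (∈-V⁺ y∈V y≢u y≢v))
      ... | _ | yes refl = ≤R-reflexive (sym (trans (rightMoveValue-continues {G = H' L[ v ]} {u} {k} ¬c)
                                                 (value-empty {G = (H' L[ v ]) R[ u ]} k Left ∉V′)))
        where
        ¬c : ¬ Completes (ER (H' L[ v ])) u
        ¬c (g , g∈ , g⊆⁅u⁆) = ¬completes-u (g , proj₁ (∈-ER-L⁻ H' v g∈) , g⊆⁅u⁆)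
        ∉V′ : ∀ {z} → z ∉ V ((H' L[ v ]) R[ u ])
        ∉V′ z∈ with ∈-V-R⁻ (H' L[ v ]) u z∈
        ... | z∈V-v , z≢u with ∈-V-L⁻ H' v z∈V-v
        ... | z∈V , z≢v = ∉V (∈-V⁺ z∈V z≢u z≢v)
      draw≤ : draw ≤R value (suc k) Right (H' L[ v ])
      draw≤ = ≤-min {c = draw} (λ _ → ≤R-refl {draw}) forced

  pairing : ∀ k p {H H'} → ∣ V H ∣ ≤ k → Paired H H' → value k p H ≤R value (suc (suc k)) p H'
  pairing zero Left fuel P = empty-left P {zero} (∣p∣≤0⇒x∉p fuel)
  pairing (suc k) Left {H} {H'} fuel P = max-≤ (λ eq → empty-left P {suc k} (moves-[]⁻ {G = H} eq)) copy
    where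
    copy : ∀ {x} → x ∈ₗ moves H → leftMoveValue k H x ≤R value (suc (suc (suc k))) Left H'
    copy {x} x∈ = ≤R-trans
      (leftMoveValue-mono {k = k} {suc (suc k)} {H} {H'} {x} {x} (completes-L P)
        λ _ → pairing k Right (∣V-L∣≤ H x∈V fuel) (Paired-L P x∈V))
      (≤-max (∈-moves⁺ {G = H'} (proj₁ (∈-V⁻ P x∈V))))
      where
      x∈V = ∈-moves⁻ {G = H} x∈
  pairing k Right {H} {H'} fuel P = ≤-min (λ eq → ⊥-elim (moves-[]⁻ {G = H'} eq u∈V)) respond
    where
    open Paired P
    respond : ∀ {y} → y ∈ₗ moves H' → value k Right H ≤R rightMoveValue (suc k) H' y
    respond {y} y∈ with y ≟ u | y ≟ v
    ... | yes refl | _ = ≤R-trans (simulation k Right (answer-u P))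
      (reply≤rightMoveValue {k = k} {H'} (¬completes-u P) (∈-V-R⁺ H' u v∈V (u≢v ∘ sym)))
    ... | no _ | yes refl = ≤R-trans (simulation k Right (answer-v P))
      (reply≤rightMoveValue {k = k} {H'} (¬completes-v P) (∈-V-R⁺ H' v u∈V u≢v))
    ... | no y≢u | no y≢v = copy k fuel
      where
      y∈V : y ∈ V H
      y∈V = ∈-V⁺ P (∈-moves⁻ {G = H'} y∈) y≢u y≢v
      copy : ∀ j → ∣ V H ∣ ≤ j → value j Right H ≤R rightMoveValue (suc j) H' y
      copy zero fuel = ⊥-elim (∣p∣≤0⇒x∉p fuel y∈V)
      copy (suc j) fuel = ≤R-trans (min-≤ (∈-moves⁺ {G = H} y∈V))
        (rightMoveValue-mono {k = j} {suc (suc j)} {H} {H'} {y} {y} (completes-R P y≢u) λ ¬c →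
          pairing j Left (∣V-R∣≤ H y∈V fuel) (Paired-R P y∈V ¬c))

o-LR[u,v]≤o : u ≢ v → u ∈ V G → v ∈ V G → Dominated u v (EL G) → Dominated u v (ER G) →
              (∀ {g} → g ∈ₗ ER G → ¬ g ⊆ ⁅ v ⁆) → o (G LR[ u , v ]) ≤L o G
o-LR[u,v]≤o {u = u} {v} {G = G} u≢v u∈V v∈V domL domR red-⊈v =
  ≤L-by-fuel {H = G LR[ u , v ]} {G} (λ p → pairing _ p ≤-refl P) refl (begin
    ∣ V G ∣                         ≡⟨ ∣p∣≡1+∣p-x∣ u∈V ⟩
    suc ∣ V G - u ∣                 ≡⟨ cong suc (∣p∣≡1+∣p-x∣ (x∈p∧x≢y⇒x∈p-y v∈V (u≢v ∘ sym))) ⟩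
    suc (suc ∣ V G - u - v ∣)       ≡⟨ cong (suc ∘ suc ∘ ∣_∣) (Paired.vertices P) ⟨
    suc (suc ∣ V (G LR[ u , v ]) ∣) ∎)
  where
  open ≡-Reasoning
  open Pairing u≢v
  P : Paired (G LR[ u , v ]) G
  P = Paired-init u∈V v∈V domL domR red-⊈v

lemma3p6 : ∀ {N} (G : Game N) (u v : Fin N) → WellFormed G
    → u ∈ V G → v ∈ V G
    → (∀ e → e ∈ₗ (EL G ++ ER G) → e ≢ ⁅ u ⁆)
    → (∀ e → e ∈ₗ (EL G ++ ER G) → e ≢ ⁅ v ⁆)
    → (∀ e → e ∈ₗ (EL G ++ ER G) → u ∈ e → v ∈ e)
    → (o (G L[ u ]) ≤L o (G L[ v ]))
      × (o (G R[ v ]) ≤L o (G R[ u ]))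
      × (u ≢ v → (o (G LR[ u , v ]) ≤L o G) × (o G ≤L o (G LR[ v , u ])))
lemma3p6 G u v wf u∈V v∈V _ ≢⁅v⁆ u∈⇒v∈ =
    o-L[u]≤o-L[v] u∈V v∈V domL domR
  , ≤L-by-dual {H = G R[ v ]} {G R[ u ]}
      (subst₂ _≤L_ (on-dual ⊥ ⁅ u ⁆) (on-dual ⊥ ⁅ v ⁆) (o-L[u]≤o-L[v] u∈V v∈V domR domL))
  , λ u≢v → o-LR[u,v]≤o u≢v u∈V v∈V domL domR (⊈⁅v⁆ ∘ ∈-++⁺ʳ (EL G))
          , ≤L-by-dual {H = G} {G LR[ v , u ]}
              (subst (_≤L o (dual G)) (on-dual ⁅ v ⁆ ⁅ u ⁆)
                (o-LR[u,v]≤o u≢v u∈V v∈V domR domL (⊈⁅v⁆ ∘ ∈-++⁺ˡ)))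
  where
  domL : Dominated u v (EL G)
  domL e∈ = u∈⇒v∈ _ (∈-++⁺ˡ e∈)
  domR : Dominated u v (ER G)
  domR e∈ = u∈⇒v∈ _ (∈-++⁺ʳ (EL G) e∈)
  ⊈⁅v⁆ : ∀ {e} → e ∈ₗ EL G ++ ER G → ¬ e ⊆ ⁅ v ⁆
  ⊈⁅v⁆ e∈ = nonempty-≢⇒⊈ (proj₂ (All-lookup wf e∈)) (≢⁅v⁆ _ e∈)
  on-dual : ∀ S T → o (after T S (dual G)) ≡ o (dual (after S T G))
  on-dual S T = cong o (sym (dual-after S T G))
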